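{- If $n\ge m\ge 3$, then $\chi_{\rho}(P_m, P_n) = 3$.
   Context: For graphs $G$ and $H$ and a function $f\colon V(G)\to V(H)$, the Sierpiński product $G\otimes_f H$ is the graph with vertex set $V(G)\times V(H)$ whose edges are: $(g,h)(g,h')$ for every $g\in V(G)$ and every edge $hh'\in E(H)$; and $(g,f(g'))(g',f(g))$ for every edge $gg'\in E(G)$. Let $H^G$ denote the set of all functions $V(G)\to V(H)$. For a graph $X$, a packing $k$-coloring is a map $c\colon V(X)\to\{1,\dots,k\}$ such that whenever $u\neq v$ and $c(u)=c(v)=\ell$, the shortest-path distance satisfies $d_X(u,v)>\ell$; the packing chromatic number $\chi_\rho(X)$ is the least $k$ for which a packing $k$-coloring exists. The Sierpiński packing chromatic number of $(G,H)$ is $\chi_\rho(G,H)=\min_{f\in H^G}\chi_\rho(G\otimes_f H)$. $P_m$ denotes the path on $m$ vertices. -}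

module Defs where

open import Level using (Level; _⊔_) renaming (suc to lsuc; zero to lzero)
open import Data.Nat using (ℕ; zero; suc; _≤_; _<_)
open import Data.Fin using (Fin; toℕ)
open import Data.Product using (Σ; _×_; _,_; ∃-syntax)
open import Data.Sum using (_⊎_)
open import Relation.Nullary using (¬_)
open import Relation.Binary.PropositionalEquality using (_≡_; _≢_)

record Graph : Set₁ where
  constructor mkGraph
  field
    V   : Set
    Adj : V → V → Set
open Graph public

PathAdj : (m : ℕ) → Fin m → Fin m → Set
PathAdj m i j = (suc (toℕ i) ≡ toℕ j) ⊎ (suc (toℕ j) ≡ toℕ i)

P : ℕ → Graph
P m = mkGraph (Fin m) (PathAdj m)

data SierpAdj (G H : Graph) (f : V G → V H) : (V G × V H) → (V G × V H) → Set where
  inner : (g : V G) (h h' : V H) → Adj H h h' → SierpAdj G H f (g , h) (g , h')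
  inner-sym : (g : V G) (h h' : V H) → Adj H h h' → SierpAdj G H f (g , h') (g , h)
  bridge : (g g' : V G) → Adj G g g' → SierpAdj G H f (g , f g') (g' , f g)
  bridge-sym : (g g' : V G) → Adj G g g' → SierpAdj G H f (g' , f g) (g , f g')

Sierpinski : (G H : Graph) → (V G → V H) → Graph
Sierpinski G H f = mkGraph (V G × V H) (SierpAdj G H f)

data Walk (X : Graph) : V X → V X → ℕ → Set where
  here : (u : V X) → Walk X u u zero
  step : {u v w : V X} {k : ℕ} → Adj X u v → Walk X v w k → Walk X u w (suc k)

-- d_X(u,v) ≤ ℓ  (shortest-path distance at most ℓ; false if disconnected).
DistLe : (X : Graph) → V X → V X → ℕ → Set
DistLe X u v ℓ = Σ ℕ (λ k → (k ≤ ℓ) × Walk X u v k)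

-- Colour c ∈ Fin k stands for the colour toℕ c + 1 ∈ {1,…,k}.
colour : {k : ℕ} → Fin k → ℕ
colour c = suc (toℕ c)

IsPackingColoring : (X : Graph) (k : ℕ) → (V X → Fin k) → Set
IsPackingColoring X k c =
  (u v : V X) → u ≢ v → c u ≡ c v → ¬ DistLe X u v (colour (c u))

PackingColorable : Graph → ℕ → Set
PackingColorable X k = Σ (V X → Fin k) (IsPackingColoring X k)

IsPackingChromaticNumber : Graph → ℕ → Set
IsPackingChromaticNumber X k =
  PackingColorable X k × ((j : ℕ) → j < k → ¬ PackingColorable X j)

IsSierpinskiPackingChromaticNumber : Graph → Graph → ℕ → Set
IsSierpinskiPackingChromaticNumber G H k =
  (Σ (V G → V H) (λ f → IsPackingChromaticNumber (Sierpinski G H f) k))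
  × ((f : V G → V H) (j : ℕ) → j < k → ¬ PackingColorable (Sierpinski G H f) j)

module Submission where

-- Let f g be the end 0 of P n when g ≡ 0, 1 (mod 4) and the far end otherwise. The bridges of
-- copy g of P n leave it at f (g - 1) and f (g + 1), which are then opposite ends, so listing the
-- copies in order, each from the first of these ends to the second, is an injective homomorphism
-- of P m ⊗_f P n into the path on m n vertices, and the packing colouring 1, 2, 1, 3, 1, 2, 1, 3, …
-- of that path pulls back. Conversely, for every f the copies 0 and 1 and the bridge
-- (0, f 1) (1, f 0) contain a path a b c d on four distinct vertices; in a packing 2-colouring its
-- colours alternate, and whichever of a, b gets colour 2 meets that colour again two steps on.

open import Defs
open import Data.Nat
  using (ℕ; zero; suc; _≤_; _<_; _+_; _*_; _∸_; ∣_-_∣; z≤n; s≤s; s≤s⁻¹; compare; less; equal; greater)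
open import Data.Nat.Properties
  using ( <⇒≱; suc-injective; ≤-reflexive; ≤-trans; +-monoˡ-≤; +-suc; +-comm; +-identityʳ; *-suc
        ; n∸n≡0; 1+n≢n; ∣n-n∣≡0; ∣m-m+n∣≡n; ∣-∣-comm; ∣-∣-triangle; module ≤-Reasoning)
open import Data.Bool using (Bool; true; false; not)
open import Data.Empty using (⊥-elim)
open import Data.Fin using (Fin; zero; suc; toℕ; fromℕ; inject₁; inject≤; combine; opposite)
open import Data.Fin.Properties
  using ( toℕ-injective; toℕ-fromℕ; toℕ-inject₁; toℕ-inject≤; inject≤-injective; toℕ-combine
        ; combine-injective; opposite-prop; opposite-involutive)
open import Data.Product using (Σ-syntax; _×_; _,_; proj₁; proj₂)
open import Data.Sum using (_⊎_; inj₁; inj₂; [_,_]; swap)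
open import Function using (_∘_; id)
open import Function.Definitions using (Injective)
open import Relation.Nullary using (¬_)
open import Relation.Binary.PropositionalEquality
  using (_≡_; _≢_; refl; sym; trans; cong; subst; subst₂; cong₂; module ≡-Reasoning)

IsHomomorphism : (X Y : Graph) → (V X → V Y) → Set
IsHomomorphism X Y φ = ∀ {u v} → Adj X u v → Adj Y (φ u) (φ v)

Walk-map : ∀ {X Y φ} → IsHomomorphism X Y φ → ∀ {u v k} → Walk X u v k → Walk Y (φ u) (φ v) k
Walk-map hom (here u)    = here _
Walk-map hom (step uv w) = step (hom uv) (Walk-map hom w)

IsPackingColoring-pullback : ∀ {X Y k c φ} → Injective _≡_ _≡_ φ → IsHomomorphism X Y φ →
                             IsPackingColoring Y k c → IsPackingColoring X k (c ∘ φ)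
IsPackingColoring-pullback {φ = φ} injective hom packing u v u≢v same (ℓ , ℓ≤ , w) =
  packing (φ u) (φ v) (u≢v ∘ injective) same (ℓ , ℓ≤ , Walk-map hom w)

PackingColorable-mono : ∀ {X j k} → j ≤ k → PackingColorable X j → PackingColorable X k
PackingColorable-mono {X} j≤k (c , packing) = (λ u → inject≤ (c u) j≤k) , packing′
  where
  packing′ : IsPackingColoring X _ (λ u → inject≤ (c u) j≤k)
  packing′ u v u≢v same rewrite toℕ-inject≤ (c u) j≤k =
    packing u v u≢v (inject≤-injective j≤k j≤k (c u) (c v) same)

colour1213 : ℕ → Fin 3
colour1213 0 = zero
colour1213 1 = suc zero
colour1213 2 = zero
colour1213 3 = suc (suc zero)
colour1213 (suc (suc (suc (suc a)))) = colour1213 a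

colour1213-spread : ∀ a k → colour1213 a ≡ colour1213 (suc (a + k)) → colour (colour1213 a) ≤ k
colour1213-spread 0 0 ()
colour1213-spread 0 (suc k) _ = s≤s z≤n
colour1213-spread 1 0 ()
colour1213-spread 1 1 ()
colour1213-spread 1 (suc (suc k)) _ = s≤s (s≤s z≤n)
colour1213-spread 2 0 ()
colour1213-spread 2 (suc k) _ = s≤s z≤n
colour1213-spread 3 0 ()
colour1213-spread 3 1 ()
colour1213-spread 3 2 ()
colour1213-spread 3 (suc (suc (suc k))) _ = s≤s (s≤s (s≤s z≤n))
colour1213-spread (suc (suc (suc (suc a)))) k same = colour1213-spread a k same

∣m-1+m+n∣≡1+n : ∀ m n → ∣ m - suc (m + n) ∣ ≡ suc n
∣m-1+m+n∣≡1+n m n = trans (cong (∣ m -_∣) (sym (+-suc m n))) (∣m-m+n∣≡n m (suc n))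

colour1213-packing : ∀ a b → a ≢ b → colour1213 a ≡ colour1213 b →
                     colour (colour1213 a) < ∣ a - b ∣
colour1213-packing a b a≢b same with compare a b
... | less .a k =
  subst (colour (colour1213 a) <_) (sym (∣m-1+m+n∣≡1+n a k)) (s≤s (colour1213-spread a k same))
... | equal .a = ⊥-elim (a≢b refl)
... | greater .b k =
  subst₂ (λ c d → colour c < d) (sym same) (trans (sym (∣m-1+m+n∣≡1+n b k)) (∣-∣-comm b _))
    (s≤s (colour1213-spread b k (sym same)))

∣n-1+n∣≡1 : ∀ n → ∣ n - suc n ∣ ≡ 1
∣n-1+n∣≡1 zero    = refl
∣n-1+n∣≡1 (suc n) = ∣n-1+n∣≡1 n

PathAdj⇒∣-∣≡1 : ∀ {n} {i j : Fin n} → PathAdj n i j → ∣ toℕ i - toℕ j ∣ ≡ 1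
PathAdj⇒∣-∣≡1 {i = i} (inj₁ i+1≡j) = subst (λ x → ∣ toℕ i - x ∣ ≡ 1) i+1≡j (∣n-1+n∣≡1 (toℕ i))
PathAdj⇒∣-∣≡1 {j = j} (inj₂ j+1≡i) =
  subst (λ x → ∣ x - toℕ j ∣ ≡ 1) j+1≡i
        (trans (∣-∣-comm (suc (toℕ j)) (toℕ j)) (∣n-1+n∣≡1 (toℕ j)))

Walk-P⇒∣-∣≤ : ∀ {n} {i j : Fin n} {k} → Walk (P n) i j k → ∣ toℕ i - toℕ j ∣ ≤ k
Walk-P⇒∣-∣≤ (here i) = ≤-reflexive (∣n-n∣≡0 (toℕ i))
Walk-P⇒∣-∣≤ {i = i} {j} {suc k} (step {v = v} iv w) = begin
  ∣ toℕ i - toℕ j ∣                     ≤⟨ ∣-∣-triangle (toℕ i) (toℕ v) (toℕ j) ⟩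
  ∣ toℕ i - toℕ v ∣ + ∣ toℕ v - toℕ j ∣ ≤⟨ +-monoˡ-≤ _ (≤-reflexive (PathAdj⇒∣-∣≡1 iv)) ⟩
  suc (∣ toℕ v - toℕ j ∣)               ≤⟨ s≤s (Walk-P⇒∣-∣≤ w) ⟩
  suc k                                 ∎
  where open ≤-Reasoning

P-isPackingColoring : ∀ n → IsPackingColoring (P n) 3 (colour1213 ∘ toℕ)
P-isPackingColoring _ i j i≢j same (k , k≤ , w) =
  <⇒≱ (colour1213-packing (toℕ i) (toℕ j) (i≢j ∘ toℕ-injective) same)
      (≤-trans (Walk-P⇒∣-∣≤ w) k≤)

PathAdj-sym : ∀ {n} {i j : Fin n} → PathAdj n i j → PathAdj n j i
PathAdj-sym = swap

PathAdj-irreflexive : ∀ {n} {i j : Fin n} → PathAdj n i j → i ≢ j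
PathAdj-irreflexive (inj₁ i+1≡j) refl = 1+n≢n i+1≡j
PathAdj-irreflexive (inj₂ j+1≡i) refl = 1+n≢n j+1≡i

P-neighbour : ∀ {n} (i : Fin (suc (suc n))) → Σ[ j ∈ Fin (suc (suc n)) ] PathAdj _ j i
P-neighbour zero    = suc zero , inj₂ refl
P-neighbour (suc i) = inject₁ i , inj₁ (cong suc (toℕ-inject₁ i))

opposite-reverses-adjacency : ∀ {n} (i j : Fin n) → suc (toℕ i) ≡ toℕ j →
                              suc (toℕ (opposite j)) ≡ toℕ (opposite i)
opposite-reverses-adjacency {suc (suc n)} zero (suc zero) refl =
  cong suc (toℕ-inject₁ (fromℕ n))
opposite-reverses-adjacency (suc i) (suc j) i+1≡j = begin
  suc (toℕ (inject₁ (opposite j))) ≡⟨ cong suc (toℕ-inject₁ (opposite j)) ⟩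
  suc (toℕ (opposite j))           ≡⟨ opposite-reverses-adjacency i j (suc-injective i+1≡j) ⟩
  toℕ (opposite i)                 ≡⟨ toℕ-inject₁ (opposite i) ⟨
  toℕ (inject₁ (opposite i))       ∎
  where open ≡-Reasoning

opposite-preserves-adjacency : ∀ {n} {i j : Fin n} → PathAdj n i j →
                               PathAdj n (opposite i) (opposite j)
opposite-preserves-adjacency (inj₁ i+1≡j) = inj₂ (opposite-reverses-adjacency _ _ i+1≡j)
opposite-preserves-adjacency (inj₂ j+1≡i) = inj₁ (opposite-reverses-adjacency _ _ j+1≡i)

combine-step : ∀ {m n} (g : Fin m) {i j : Fin n} → suc (toℕ i) ≡ toℕ j →
               suc (toℕ (combine g i)) ≡ toℕ (combine g j)
combine-step {n = n} g {i} {j} i+1≡j = begin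
  suc (toℕ (combine g i)) ≡⟨ cong suc (toℕ-combine g i) ⟩
  suc (n * toℕ g + toℕ i) ≡⟨ +-suc (n * toℕ g) (toℕ i) ⟨
  n * toℕ g + suc (toℕ i) ≡⟨ cong (n * toℕ g +_) i+1≡j ⟩
  n * toℕ g + toℕ j       ≡⟨ toℕ-combine g j ⟨
  toℕ (combine g j)       ∎
  where open ≡-Reasoning

combine-preserves-adjacency : ∀ {m n} (g : Fin m) {i j : Fin n} → PathAdj n i j →
                              PathAdj (m * n) (combine g i) (combine g j)
combine-preserves-adjacency g (inj₁ i+1≡j) = inj₁ (combine-step g i+1≡j)
combine-preserves-adjacency g (inj₂ j+1≡i) = inj₂ (combine-step g j+1≡i)

combine-last-adjacent-first : ∀ {m n} {g g′ : Fin m} {i j : Fin (suc n)} →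
                              suc (toℕ g) ≡ toℕ g′ → toℕ i ≡ n → toℕ j ≡ 0 →
                              suc (toℕ (combine g i)) ≡ toℕ (combine g′ j)
combine-last-adjacent-first {n = n} {g} {g′} {i} {j} g+1≡g′ i≡n j≡0 = begin
  suc (toℕ (combine g i))     ≡⟨ cong suc (toℕ-combine g i) ⟩
  suc (suc n * toℕ g + toℕ i) ≡⟨ cong (λ x → suc (suc n * toℕ g + x)) i≡n ⟩
  suc (suc n * toℕ g + n)     ≡⟨ cong suc (+-comm _ n) ⟩
  suc n + suc n * toℕ g       ≡⟨ *-suc (suc n) (toℕ g) ⟨
  suc n * suc (toℕ g)         ≡⟨ +-identityʳ _ ⟨
  suc n * suc (toℕ g) + 0     ≡⟨ cong₂ (λ x y → suc n * x + y) g+1≡g′ (sym j≡0) ⟩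
  suc n * toℕ g′ + toℕ j      ≡⟨ toℕ-combine g′ j ⟨
  toℕ (combine g′ j)          ∎
  where open ≡-Reasoning

endpoint : ∀ {n} → Bool → Fin (suc n)
endpoint true  = zero
endpoint false = fromℕ _

orient : ∀ {n} → Bool → Fin n → Fin n
orient true  = opposite
orient false = id

orient-injective : ∀ {n} b → Injective _≡_ _≡_ (orient {n} b)
orient-injective true  {i} {j} same =
  trans (sym (opposite-involutive i)) (trans (cong opposite same) (opposite-involutive j))
orient-injective false same = same

orient-preserves-adjacency : ∀ {n} b {i j : Fin n} → PathAdj n i j →
                             PathAdj n (orient b i) (orient b j)
orient-preserves-adjacency true  = opposite-preserves-adjacency
orient-preserves-adjacency false = id

toℕ-orient-endpoint : ∀ {n} b → toℕ (orient b (endpoint {n} b)) ≡ n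
toℕ-orient-endpoint true  = toℕ-fromℕ _
toℕ-orient-endpoint false = toℕ-fromℕ _

toℕ-orient-not-endpoint : ∀ {n} b → toℕ (orient (not b) (endpoint {n} b)) ≡ 0
toℕ-orient-not-endpoint      true  = refl
toℕ-orient-not-endpoint {n} false = begin
  toℕ (opposite (fromℕ n)) ≡⟨ opposite-prop (fromℕ n) ⟩
  n ∸ toℕ (fromℕ n)        ≡⟨ cong (n ∸_) (toℕ-fromℕ n) ⟩
  n ∸ n                    ≡⟨ n∸n≡0 n ⟩
  0                        ∎
  where open ≡-Reasoning

module Snake (m n : ℕ) where

  attachesAtZero : ℕ → Bool
  attachesAtZero 0 = true
  attachesAtZero 1 = true
  attachesAtZero (suc (suc g)) = not (attachesAtZero g)

  f : Fin m → Fin (suc n)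
  f g = endpoint (attachesAtZero (toℕ g))

  reversed : Fin m → Bool
  reversed g = attachesAtZero (suc (toℕ g))

  embed : Fin m × Fin (suc n) → Fin (m * suc n)
  embed (g , h) = combine g (orient (reversed g) h)

  embed-injective : Injective _≡_ _≡_ embed
  embed-injective {g , h} {g′ , h′} same
    with refl , same′ ← combine-injective g (orient (reversed g) h) g′ (orient (reversed g′) h′)
                                          same
    = cong (g ,_) (orient-injective (reversed g) same′)

  bridge-step : ∀ {g g′ : Fin m} → suc (toℕ g) ≡ toℕ g′ →
                suc (toℕ (embed (g , f g′))) ≡ toℕ (embed (g′ , f g))
  bridge-step {g} {g′} g+1≡g′ = combine-last-adjacent-first g+1≡g′ exit entry
    where
    exit : toℕ (orient (reversed g) (f g′)) ≡ n
    exit = subst (λ x → toℕ (orient (reversed g) (endpoint (attachesAtZero x))) ≡ n)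
                 g+1≡g′ (toℕ-orient-endpoint (reversed g))
    entry : toℕ (orient (reversed g′) (f g)) ≡ 0
    entry = subst (λ x → toℕ (orient (attachesAtZero (suc x)) (f g)) ≡ 0)
                  g+1≡g′ (toℕ-orient-not-endpoint (attachesAtZero (toℕ g)))

  embed-homomorphism : IsHomomorphism (Sierpinski (P m) (P (suc n)) f) (P (m * suc n)) embed
  embed-homomorphism (inner g _ _ hh′) =
    combine-preserves-adjacency g (orient-preserves-adjacency (reversed g) hh′)
  embed-homomorphism (inner-sym g _ _ hh′) =
    PathAdj-sym (combine-preserves-adjacency g (orient-preserves-adjacency (reversed g) hh′))
  embed-homomorphism (bridge _ _ (inj₁ g+1≡g′))     = inj₁ (bridge-step g+1≡g′)
  embed-homomorphism (bridge _ _ (inj₂ g′+1≡g))     = inj₂ (bridge-step g′+1≡g)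
  embed-homomorphism (bridge-sym _ _ (inj₁ g+1≡g′)) = inj₂ (bridge-step g+1≡g′)
  embed-homomorphism (bridge-sym _ _ (inj₂ g′+1≡g)) = inj₁ (bridge-step g′+1≡g)

Sierpinski-P-packingColorable : ∀ m n →
  Σ[ f ∈ (Fin m → Fin (suc n)) ] PackingColorable (Sierpinski (P m) (P (suc n)) f) 3
Sierpinski-P-packingColorable m n =
  f , colour1213 ∘ toℕ ∘ embed ,
  IsPackingColoring-pullback embed-injective embed-homomorphism (P-isPackingColoring (m * suc n))
  where open Snake m n

Fin2-≢-trans : {x y z : Fin 2} → x ≢ y → y ≢ z → x ≡ z
Fin2-≢-trans {zero}     {_}        {zero}     _   _   = refl
Fin2-≢-trans {suc zero} {_}        {suc zero} _   _   = refl
Fin2-≢-trans {zero}     {zero}     {suc zero} x≢y _   = ⊥-elim (x≢y refl)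
Fin2-≢-trans {zero}     {suc zero} {suc zero} _   y≢z = ⊥-elim (y≢z refl)
Fin2-≢-trans {suc zero} {zero}     {zero}     _   y≢z = ⊥-elim (y≢z refl)
Fin2-≢-trans {suc zero} {suc zero} {zero}     x≢y _   = ⊥-elim (x≢y refl)

Fin2-≢⇒one-is-1 : {x y : Fin 2} → x ≢ y → x ≡ suc zero ⊎ y ≡ suc zero
Fin2-≢⇒one-is-1 {suc zero}        _   = inj₁ refl
Fin2-≢⇒one-is-1 {zero} {suc zero} _   = inj₂ refl
Fin2-≢⇒one-is-1 {zero} {zero}     x≢y = ⊥-elim (x≢y refl)

P₄-not-packing-2-colorable : ∀ {X : Graph} {a b c d : V X} → Adj X a b → Adj X b c → Adj X c d →
                             a ≢ b → b ≢ c → c ≢ d → a ≢ c → b ≢ d → ¬ PackingColorable X 2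
P₄-not-packing-2-colorable {X} {a} {b} {c} {d} ab bc cd a≢b b≢c c≢d a≢c b≢d (κ , packing) =
  [ colour-2-not-two-apart ab bc a≢c (Fin2-≢-trans κa≢κb κb≢κc)
  , colour-2-not-two-apart bc cd b≢d (Fin2-≢-trans κb≢κc κc≢κd)
  ] (Fin2-≢⇒one-is-1 κa≢κb)
  where
  adjacent-differ : ∀ {u v} → Adj X u v → u ≢ v → κ u ≢ κ v
  adjacent-differ {v = v} uv u≢v same = packing _ v u≢v same (1 , s≤s z≤n , step uv (here v))

  colour-2-not-two-apart : ∀ {u v w} → Adj X u v → Adj X v w → u ≢ w → κ u ≡ κ w → κ u ≢ suc zero
  colour-2-not-two-apart {u} {w = w} uv vw u≢w same κu≡1 =
    packing u w u≢w same (2 , ≤-reflexive (cong colour (sym κu≡1)) , step uv (step vw (here w)))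

  κa≢κb : κ a ≢ κ b
  κa≢κb = adjacent-differ ab a≢b
  κb≢κc : κ b ≢ κ c
  κb≢κc = adjacent-differ bc b≢c
  κc≢κd : κ c ≢ κ d
  κc≢κd = adjacent-differ cd c≢d

Sierpinski-not-packing-2-colorable :
  ∀ {G H : Graph} (f : V G → V H) {g g′ : V G} → Adj G g g′ → g ≢ g′ →
  (∀ h → Σ[ h′ ∈ V H ] Adj H h′ h) → (∀ {h h′} → Adj H h h′ → h ≢ h′) →
  ¬ PackingColorable (Sierpinski G H f) 2
Sierpinski-not-packing-2-colorable f {g} {g′} gg′ g≢g′ neighbour loopless
  with (h₁ , h₁~) ← neighbour (f g′) | (h₂ , h₂~) ← neighbour (f g) =
  P₄-not-packing-2-colorable
    (inner g h₁ (f g′) h₁~) (bridge g g′ gg′) (inner-sym g′ h₂ (f g) h₂~)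
    (loopless h₁~ ∘ cong proj₂) (g≢g′ ∘ cong proj₁) (loopless h₂~ ∘ sym ∘ cong proj₂)
    (g≢g′ ∘ cong proj₁) (g≢g′ ∘ cong proj₁)

theorem4p1 : (m n : ℕ) → 3 ≤ m → m ≤ n →
    IsSierpinskiPackingChromaticNumber (P m) (P n) 3
theorem4p1 (suc (suc m)) (suc (suc n)) (s≤s (s≤s _)) (s≤s (s≤s _))
  with f , colorable ← Sierpinski-P-packingColorable (suc (suc m)) (suc n) =
  (f , colorable , fewer-colours-fail f) , fewer-colours-fail
  where
  fewer-colours-fail : ∀ f′ j → j < 3 →
                       ¬ PackingColorable (Sierpinski (P (suc (suc m))) (P (suc (suc n))) f′) j
  fewer-colours-fail f′ j j<3 =
    Sierpinski-not-packing-2-colorable f′ {zero} {suc zero} (inj₁ refl) (λ ())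
                                       P-neighbour PathAdj-irreflexive
    ∘ PackingColorable-mono (s≤s⁻¹ j<3)
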